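{- Let $T$ be a $d$-parking tree on $n=dk+1$ vertices and let $\omega$ be an increasing ordering of its vertices. For $1\le i\le k$ let $a_i=\omega(p)$, where $p$ is the common parent of the vertices labeled $i_1,i_2,\dots,i_d$. Then $(a_1,a_2,\dots,a_k)$ is a $d$-parking function.
   Context: A $d$-parking tree is a rooted plane tree on $n=dk+1$ vertices in which the number of children of each vertex is a multiple of $d$, with vertex labels satisfying: (1) the root is labeled $\infty$; (2) every other vertex has a label $i_j$ with $i\in\{1,\dots,k\}$, $j\in\{1,\dots,d\}$; (3) for each fixed $i$, the vertices $i_1,\dots,i_d$ are children of a common parent and are consecutive in the left-to-right order of its children, in this order; (4) each $i\in\{1,\dots,k\}$ labels exactly one such $d$-element set of siblings (so each label $i_j$ is used exactly once); (5) if $i_j$ and $i'_{j'}$ are children of the same vertex and $i<i'$, then $i_j$ is to the right of $i'_{j'}$. An increasing ordering of a tree on $n$ vertices is a bijection $\omega$ from its vertex set to $\{1,\dots,n\}$ such that $\omega(u)<\omega(v)$ whenever $u$ is the parent of $v$. A $d$-parking function of length $k$ is a list $(a_1,\dots,a_k)$ of positive integers whose nondecreasing rearrangement $a_{(1)}\le\cdots\le a_{(k)}$ satisfies $a_{(i)}\le d(i-1)+1$ for all $i$. -}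

module Defs where

open import Data.Nat using (ℕ; zero; suc; _+_; _*_; _≤_; _<_)
open import Data.Nat.Properties using (≤-totalOrder)
open import Data.Fin as Fin using (Fin; toℕ)
open import Data.List as List using (List; []; _∷_; _++_; map; concatMap; length; lookup; allFin)
open import Data.List.Relation.Unary.All using (All)
open import Data.List.Relation.Unary.Linked using (Linked)
open import Data.List.Relation.Binary.Permutation.Propositional using (_↭_)
open import Data.Maybe using (Maybe; just; nothing)
open import Data.Product using (_×_; _,_; ∃; Σ)
open import Relation.Binary.PropositionalEquality using (_≡_)
open import Function.Definitions using (Bijective)

data Tree (L : Set) : Set where
  node : L → List (Tree L) → Tree L

rootLabel : {L : Set} → Tree L → L
rootLabel (node l _) = l

children : {L : Set} → Tree L → List (Tree L)
children (node _ ts) = ts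

mutual
  labels : {L : Set} → Tree L → List L
  labels (node l ts) = l ∷ labelsF ts

  labelsF : {L : Set} → List (Tree L) → List L
  labelsF [] = []
  labelsF (t ∷ ts) = labels t ++ labelsF ts

data AllNodes {L : Set} (P : Tree L → Set) : Tree L → Set where
  allNodes : ∀ {l ts} → P (node l ts) → All (AllNodes P) ts → AllNodes P (node l ts)

-- vertices of a plane tree, as positions (paths from the root)
data Pos {L : Set} : Tree L → Set where
  here  : ∀ {T} → Pos T
  there : ∀ {l ts} (c : Fin (length ts)) → Pos (lookup ts c) → Pos (node l ts)

labelAt : {L : Set} {T : Tree L} → Pos T → L
labelAt {T = T} here = rootLabel T
labelAt {T = node l ts} (there c p) = labelAt p

data Parent {L : Set} : (T : Tree L) → Pos T → Pos T → Set where
  parent-here  : ∀ {l ts} (c : Fin (length ts)) →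
                 Parent (node l ts) here (there c here)
  parent-there : ∀ {l ts} (c : Fin (length ts)) {u v : Pos (lookup ts c)} →
                 Parent (lookup ts c) u v →
                 Parent (node l ts) (there c u) (there c v)

-- d-parking trees.  Labels: nothing = ∞ (the root), just (i , j) = i_j,
-- with i ∈ Fin k standing for {1,…,k} and j ∈ Fin d for {1,…,d}.

Label : ℕ → ℕ → Set
Label k d = Maybe (Fin k × Fin d)

block : {k : ℕ} (d : ℕ) → Fin k → List (Label k d)
block d i = map (λ j → just (i , j)) (allFin d)

allLabels : (k d : ℕ) → List (Fin k × Fin d)
allLabels k d = concatMap (λ i → map (λ j → (i , j)) (allFin d)) (allFin k)

-- Local condition at a vertex: the left-to-right list of the labels of its
-- children is a concatenation of complete blocks i_1 … i_d (conditions (3)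
-- and "number of children is a multiple of d"), whose indices i strictly
-- decrease from left to right (condition (5)).
LocalOK : (k d : ℕ) → Tree (Label k d) → Set
LocalOK k d t =
  ∃ λ (is : List (Fin k)) →
    (map rootLabel (children t) ≡ concatMap (block d) is) ×
    Linked (λ i i′ → i′ Fin.< i) is

record IsParkingTree (k d : ℕ) (T : Tree (Label k d)) : Set where
  field
    root-∞     : rootLabel T ≡ nothing
    local      : AllNodes (LocalOK k d) T
    -- (2),(4): every label i_j is used exactly once, ∞ once, nothing else
    labels-perm : labels T ↭ (nothing ∷ map just (allLabels k d))

-- An increasing ordering of T with n vertices: a bijection
-- ω : vertices → {1,…,n}; here Fin n, with vertex v getting the number
-- suc (toℕ (ω v)).
record IncreasingOrdering {L : Set} (T : Tree L) (n : ℕ) : Set where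
  field
    ω          : Pos T → Fin n
    bijective  : Bijective _≡_ _≡_ ω
    increasing : ∀ {u v} → Parent T u v → toℕ (ω u) < toℕ (ω v)

-- d-parking functions: some nondecreasing rearrangement (b₀,…,b_{k-1})
-- of the list of positive integers satisfies b_i ≤ d·i + 1 (0-indexed,
-- i.e. a_(i) ≤ d(i-1)+1 for the 1-indexed i).

IsDParkingFunction : ℕ → List ℕ → Set
IsDParkingFunction d as =
  All (λ a → 1 ≤ a) as ×
  ∃ λ (bs : List ℕ) →
    (bs ↭ as) × Linked _≤_ bs ×
    (∀ (i : Fin (length bs)) → lookup bs i ≤ d * toℕ i + 1)

{-# OPTIONS --safe #-}
-- Fix m < k and put c = dm + 1 ≤ dk.  The c vertices that ω numbers 2, …, c + 1 are not the
-- root, so they carry c distinct labels i_j, and the parent of each has a smaller number, so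
-- a_i ≤ c.  Each i accounts for at most d labels, hence more than m of the a_i are ≤ dm + 1,
-- which says that the (m+1)-st smallest of them is ≤ dm + 1.  That a_i may be read off any
-- vertex of block i is condition (3): the vertices i_1, …, i_d have a common parent.
module Submission where

open import Defs
open import Data.Bool using (true; false)
open import Data.Nat using (ℕ; suc; _+_; _*_; _≤_; _<_; z≤n; s≤s; z<s; s<s⁻¹; _≤?_)
open import Data.Nat.Properties
open import Data.Fin using (Fin; zero; suc; toℕ; fromℕ<; combine)
open import Data.Fin.Properties using (toℕ<n; toℕ-fromℕ<; toℕ-injective; injective⇒≤; combine-injectiveˡ; combine-injectiveʳ)
open import Data.List using (List; []; _∷_; _++_; map; concatMap; length; lookup; tabulate; allFin; filter; cartesianProduct)
open import Data.List.Properties using (length-map; length-tabulate; map-tabulate; filter-none)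
open import Data.List.Relation.Unary.All as All using (All; []; _∷_)
import Data.List.Relation.Unary.All.Properties as All
open import Data.List.Relation.Unary.Any as Any using (here; there)
open import Data.List.Relation.Unary.Any.Properties using (lookup-index)
open import Data.List.Relation.Unary.Linked as Linked using (Linked)
open import Data.List.Relation.Unary.Linked.Properties using (Linked⇒All)
open import Data.List.Relation.Unary.Unique.Propositional using (Unique; []; _∷_)
import Data.List.Relation.Unary.Unique.Propositional.Properties as Unique
open import Data.List.Relation.Binary.Disjoint.Propositional using (Disjoint)
open import Data.List.Membership.Propositional using (_∈_)
open import Data.List.Membership.Propositional.Properties using (∈-++⁺ˡ; ∈-++⁺ʳ; ∈-allFin; ∈-filter⁺; ∈-lookup; ∈-map⁺; ∈-map⁻; ∈-concatMap⁺; ∈-concatMap⁻)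
open import Data.List.Relation.Binary.Permutation.Propositional using (↭-sym; ↭⇒↭ₛ)
open import Data.List.Relation.Binary.Permutation.Propositional.Properties using (↭-length; filter-↭)
open import Data.List.Relation.Binary.Permutation.Setoid.Properties using (Unique-resp-↭)
open import Data.List.Sort ≤-decTotalOrder using (sort; sort-↭; sort-↗)
open import Data.Maybe using (just; nothing)
open import Data.Maybe.Properties using (just-injective)
open import Data.Product using (_×_; _,_; ∃; proj₁; proj₂)
open import Data.Sum using (_⊎_; inj₁; inj₂)
open import Function using (_∘_; id)
open import Function.Definitions using (Injective)
open import Relation.Binary.PropositionalEquality using (_≡_; refl; sym; trans; cong; cong₂; subst; setoid; module ≡-Reasoning)
open import Relation.Nullary using (does; contradiction)
open import Relation.Nullary.Decidable using (decidable-stable)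
open import Relation.Unary using (Decidable)

module _ {A B : Set} {P : B → Set} (P? : Decidable P) where

  filter-map : (f : A → B) (xs : List A) → filter P? (map f xs) ≡ map f (filter (P? ∘ f) xs)
  filter-map f [] = refl
  filter-map f (x ∷ xs) with does (P? (f x))
  ... | true  = cong (f x ∷_) (filter-map f xs)
  ... | false = filter-map f xs

module _ {A : Set} where

  Unique-++⁻ˡ : ∀ xs {ys : List A} → Unique (xs ++ ys) → Unique xs
  Unique-++⁻ˡ []       _        = []
  Unique-++⁻ˡ (x ∷ xs) (x∉ ∷ u) = All.++⁻ˡ xs x∉ ∷ Unique-++⁻ˡ xs u

  Unique-++⁻ʳ : ∀ xs {ys : List A} → Unique (xs ++ ys) → Unique ys
  Unique-++⁻ʳ []       u       = u
  Unique-++⁻ʳ (x ∷ xs) (_ ∷ u) = Unique-++⁻ʳ xs u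

  Unique-++⇒Disjoint : ∀ xs {ys : List A} → Unique (xs ++ ys) → Disjoint xs ys
  Unique-++⇒Disjoint (x ∷ xs) (x∉ ∷ _) (here refl , x∈ys) = All.lookup x∉ (∈-++⁺ʳ xs x∈ys) refl
  Unique-++⇒Disjoint (x ∷ xs) (_ ∷ u)  (there v∈xs , v∈ys) = Unique-++⇒Disjoint xs u (v∈xs , v∈ys)

∈-map⇒lookup : {A B : Set} {f : A → B} {xs : List A} {y : B} →
               y ∈ map f xs → ∃ λ c → f (lookup xs c) ≡ y
∈-map⇒lookup {xs = x ∷ xs} (here y≡fx) = zero , sym y≡fx
∈-map⇒lookup {xs = x ∷ xs} (there y∈) = let c , fxc≡y = ∈-map⇒lookup y∈ in suc c , fxc≡y

concatMap-pairs≡cartesianProduct : {A B : Set} (xs : List A) (ys : List B) →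
                                   concatMap (λ x → map (x ,_) ys) xs ≡ cartesianProduct xs ys
concatMap-pairs≡cartesianProduct []       ys = refl
concatMap-pairs≡cartesianProduct (x ∷ xs) ys = cong (map (x ,_) ys ++_) (concatMap-pairs≡cartesianProduct xs ys)

lookup-≤-of-count : ∀ c {bs} → Linked _≤_ bs → (i : Fin (length bs)) →
                    toℕ i < length (filter (_≤? c) bs) → lookup bs i ≤ c
lookup-≤-of-count c {b ∷ bs} sorted zero i<count = decidable-stable (b ≤? c) λ b≰c →
  >⇒≢ i<count (cong length (filter-none (_≤? c)
    (All.map (λ b≤x x≤c → b≰c (≤-trans b≤x x≤c)) (Linked⇒All ≤-trans ≤-refl sorted))))
lookup-≤-of-count c {b ∷ bs} sorted (suc i) i<count with does (b ≤? c)
... | true  = lookup-≤-of-count c (Linked.tail sorted) i (s<s⁻¹ i<count)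
... | false = lookup-≤-of-count c (Linked.tail sorted) i (<-trans (n<1+n _) i<count)

parking-criterion : ∀ {k} d (a : Fin k → ℕ) → (∀ i → 1 ≤ a i) →
                    (∀ m → m < k → m < length (filter (λ i → a i ≤? d * m + 1) (allFin k))) →
                    IsDParkingFunction d (tabulate a)
parking-criterion {k} d a positive enough =
  All.tabulate⁺ positive , sort (tabulate a) , sort-↭ (tabulate a) , sort-↗ (tabulate a) , bound
  where
  count-sort : ∀ c → length (filter (_≤? c) (sort (tabulate a))) ≡
                     length (filter (λ i → a i ≤? c) (allFin k))
  count-sort c = begin
    length (filter (_≤? c) (sort (tabulate a)))
      ≡⟨ ↭-length (filter-↭ (_≤? c) (sort-↭ (tabulate a))) ⟩
    length (filter (_≤? c) (tabulate a))
      ≡⟨ cong (length ∘ filter (_≤? c)) (map-tabulate id a) ⟨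
    length (filter (_≤? c) (map a (allFin k)))
      ≡⟨ cong length (filter-map (_≤? c) a (allFin k)) ⟩
    length (map a (filter (λ i → a i ≤? c) (allFin k)))
      ≡⟨ length-map a (filter (λ i → a i ≤? c) (allFin k)) ⟩
    length (filter (λ i → a i ≤? c) (allFin k))
      ∎
    where open ≡-Reasoning

  bound : ∀ i → lookup (sort (tabulate a)) i ≤ d * toℕ i + 1
  bound i = lookup-≤-of-count _ (sort-↗ (tabulate a)) i
    (subst (toℕ i <_) (sym (count-sort _)) (enough (toℕ i) i<k))
    where
    i<k : toℕ i < k
    i<k = subst (toℕ i <_) (trans (↭-length (sort-↭ (tabulate a))) (length-tabulate a)) (toℕ<n i)

injective⇒≤-count : ∀ {c k d} {P : Fin k → Set} (P? : Decidable P) (h : Fin c → Fin k × Fin d) →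
                    Injective _≡_ _≡_ h → (∀ t → P (proj₁ (h t))) →
                    c ≤ d * length (filter P? (allFin k))
injective⇒≤-count {c} {k} {d} P? h h-injective P-h =
  subst (c ≤_) (*-comm (length S) d) (injective⇒≤ g-injective)
  where
  S : List (Fin k)
  S = filter P? (allFin k)

  i∈S : ∀ t → proj₁ (h t) ∈ S
  i∈S t = ∈-filter⁺ P? (∈-allFin (proj₁ (h t))) (P-h t)

  g : Fin c → Fin (length S * d)
  g t = combine (Any.index (i∈S t)) (proj₂ (h t))

  g-injective : Injective _≡_ _≡_ g
  g-injective {t} {t′} gt≡gt′ = h-injective (cong₂ _,_ same-i same-j)
    where
    open ≡-Reasoning
    same-index : Any.index (i∈S t) ≡ Any.index (i∈S t′)
    same-index = combine-injectiveˡ _ (proj₂ (h t)) _ (proj₂ (h t′)) gt≡gt′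
    same-i : proj₁ (h t) ≡ proj₁ (h t′)
    same-i = begin
      proj₁ (h t)                    ≡⟨ lookup-index (i∈S t) ⟩
      lookup S (Any.index (i∈S t))   ≡⟨ cong (lookup S) same-index ⟩
      lookup S (Any.index (i∈S t′))  ≡⟨ lookup-index (i∈S t′) ⟨
      proj₁ (h t′)                   ∎
    same-j : proj₂ (h t) ≡ proj₂ (h t′)
    same-j = combine-injectiveʳ (Any.index (i∈S t)) _ (Any.index (i∈S t′)) _ gt≡gt′

m<n⇒d*m+1≤d*n : ∀ {d m n} → 1 ≤ d → m < n → d * m + 1 ≤ d * n
m<n⇒d*m+1≤d*n {d} {m} {n} 1≤d m<n = begin
  d * m + 1  ≤⟨ +-monoʳ-≤ (d * m) 1≤d ⟩
  d * m + d  ≡⟨ +-comm (d * m) d ⟩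
  d + d * m  ≡⟨ *-suc d m ⟨
  d * suc m  ≤⟨ *-monoʳ-≤ d m<n ⟩
  d * n      ∎
  where open ≤-Reasoning

d*m+1≤d*n⇒m<n : ∀ d {m n} → d * m + 1 ≤ d * n → m < n
d*m+1≤d*n⇒m<n d {m} {n} le = *-cancelˡ-< d m n (subst (_≤ d * n) (+-comm (d * m) 1) le)

module _ {L : Set} where

  root-or-child : {T : Tree L} (v : Pos T) → v ≡ here ⊎ ∃ λ u → Parent T u v
  root-or-child here = inj₁ refl
  root-or-child (there c v) with root-or-child v
  ... | inj₁ refl      = inj₂ (here , parent-here c)
  ... | inj₂ (u , u→v) = inj₂ (there c u , parent-there c u→v)

  Parent-unique : {T : Tree L} {u u′ v : Pos T} → Parent T u v → Parent T u′ v → u ≡ u′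
  Parent-unique (parent-here c)      (parent-here .c)      = refl
  Parent-unique (parent-there c u→v) (parent-there .c u′→v) = cong (there c) (Parent-unique u→v u′→v)

  ∈-labelsF : (ts : List (Tree L)) (c : Fin (length ts)) {x : L} → x ∈ labels (lookup ts c) → x ∈ labelsF ts
  ∈-labelsF (t ∷ ts) zero    x∈ = ∈-++⁺ˡ x∈
  ∈-labelsF (t ∷ ts) (suc c) x∈ = ∈-++⁺ʳ (labels t) (∈-labelsF ts c x∈)

  labelAt∈labels : {T : Tree L} (p : Pos T) → labelAt p ∈ labels T
  labelAt∈labels {node l ts} here        = here refl
  labelAt∈labels {node l ts} (there c p) = there (∈-labelsF ts c (labelAt∈labels p))

  Unique-labelsF-lookup : (ts : List (Tree L)) (c : Fin (length ts)) →
                          Unique (labelsF ts) → Unique (labels (lookup ts c))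
  Unique-labelsF-lookup (t ∷ ts) zero    u = Unique-++⁻ˡ (labels t) u
  Unique-labelsF-lookup (t ∷ ts) (suc c) u = Unique-labelsF-lookup ts c (Unique-++⁻ʳ (labels t) u)

  labelsF-lookup-disjoint : (ts : List (Tree L)) {c c′ : Fin (length ts)} {x : L} → Unique (labelsF ts) →
                            x ∈ labels (lookup ts c) → x ∈ labels (lookup ts c′) → c ≡ c′
  labelsF-lookup-disjoint (t ∷ ts) {zero}  {zero}   u x∈ x∈′ = refl
  labelsF-lookup-disjoint (t ∷ ts) {zero}  {suc c′} u x∈ x∈′ =
    contradiction (x∈ , ∈-labelsF ts c′ x∈′) (Unique-++⇒Disjoint (labels t) u)
  labelsF-lookup-disjoint (t ∷ ts) {suc c} {zero}   u x∈ x∈′ =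
    contradiction (x∈′ , ∈-labelsF ts c x∈) (Unique-++⇒Disjoint (labels t) u)
  labelsF-lookup-disjoint (t ∷ ts) {suc c} {suc c′} u x∈ x∈′ =
    cong suc (labelsF-lookup-disjoint ts (Unique-++⁻ʳ (labels t) u) x∈ x∈′)

  labelAt-injective : {T : Tree L} → Unique (labels T) → {p q : Pos T} → labelAt p ≡ labelAt q → p ≡ q
  labelAt-injective {node l ts} u {here} {here} _ = refl
  labelAt-injective {node l ts} u {here} {there c q} l≡q =
    contradiction (subst (_∈ labelsF ts) (sym l≡q) (∈-labelsF ts c (labelAt∈labels q)))
                  (Unique.Unique[x∷xs]⇒x∉xs u)
  labelAt-injective {node l ts} u {there c p} {here} p≡l =
    contradiction (subst (_∈ labelsF ts) p≡l (∈-labelsF ts c (labelAt∈labels p)))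
                  (Unique.Unique[x∷xs]⇒x∉xs u)
  labelAt-injective {node l ts} (_ ∷ u) {there c p} {there c′ q} p≡q
    with refl ← labelsF-lookup-disjoint ts u (labelAt∈labels p)
                  (subst (_∈ labels (lookup ts c′)) (sym p≡q) (labelAt∈labels q))
    = cong (there c) (labelAt-injective (Unique-labelsF-lookup ts c u) p≡q)

module _ {L : Set} {T : Tree L} {n : ℕ} (O : IncreasingOrdering T n) where
  open IncreasingOrdering O

  ω⁻¹ : Fin n → Pos T
  ω⁻¹ y = proj₁ (proj₂ bijective y)

  ω-ω⁻¹ : ∀ y → ω (ω⁻¹ y) ≡ y
  ω-ω⁻¹ y = proj₂ (proj₂ bijective y) refl

  ω≡0⇒root : ∀ {v} → toℕ (ω v) ≡ 0 → v ≡ here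
  ω≡0⇒root {v} ω≡0 with root-or-child v
  ... | inj₁ v≡here    = v≡here
  ... | inj₂ (u , u→v) = contradiction (subst (toℕ (ω u) <_) ω≡0 (increasing u→v)) n≮0

  ω-root : toℕ (ω here) ≡ 0
  ω-root = trans (cong (toℕ ∘ ω) (sym (ω≡0⇒root ω-first))) ω-first
    where
    first : Fin n
    first = fromℕ< (≤-<-trans z≤n (toℕ<n (ω here)))
    ω-first : toℕ (ω (ω⁻¹ first)) ≡ 0
    ω-first = trans (cong toℕ (ω-ω⁻¹ first)) (toℕ-fromℕ< _)

  ω>0⇒child : ∀ {v} → 0 < toℕ (ω v) → ∃ λ u → Parent T u v
  ω>0⇒child {v} ω>0 with root-or-child v
  ... | inj₁ refl = contradiction ω-root (>⇒≢ ω>0)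
  ... | inj₂ u→v  = u→v

Unique-allLabels : ∀ k d → Unique (allLabels k d)
Unique-allLabels k d = subst Unique (sym (concatMap-pairs≡cartesianProduct (allFin k) (allFin d)))
  (Unique.cartesianProduct⁺ (Unique.allFin⁺ k) (Unique.allFin⁺ d))

block-member : ∀ {k d} {is : List (Fin k)} {i : Fin k} {j : Fin d} →
               just (i , j) ∈ concatMap (block d) is → ∀ j′ → just (i , j′) ∈ concatMap (block d) is
block-member {d = d} {is} {i} {j} ij∈ j′ =
  ∈-concatMap⁺ (block d) (Any.map swap (∈-concatMap⁻ (block d) {xs = is} ij∈))
  where
  swap : ∀ {i′} → just (i , j) ∈ block d i′ → just (i , j′) ∈ block d i′
  swap ij∈block with _ , _ , refl ← ∈-map⁻ _ ij∈block = ∈-map⁺ _ (∈-allFin j′)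

block-sibling : ∀ {k d} {T : Tree (Label k d)} → AllNodes (LocalOK k d) T →
                ∀ {p v i j} → Parent T p v → labelAt v ≡ just (i , j) →
                (j′ : Fin d) → ∃ λ v′ → Parent T p v′ × labelAt v′ ≡ just (i , j′)
block-sibling {d = d} (allNodes {ts = ts} (is , children≡ , _) _) {i = i} {j} (parent-here c) c≡ij j′ =
  let c′ , c′≡ij′ = ∈-map⇒lookup (subst (just (i , j′) ∈_) (sym children≡)
                                         (block-member {is = is} ij∈blocks j′))
  in there c′ here , parent-here c′ , c′≡ij′
  where
  ij∈blocks : just (i , j) ∈ concatMap (block d) is
  ij∈blocks = subst (just (i , j) ∈_) children≡
                    (subst (_∈ map rootLabel ts) c≡ij (∈-map⁺ rootLabel (∈-lookup c)))
block-sibling (allNodes _ subtrees) (parent-there c p→v) v≡ij j′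
  with v′ , p→v′ , v′≡ij′ ← block-sibling (All.lookup subtrees (∈-lookup c)) p→v v≡ij j′
  = there c v′ , parent-there c p→v′ , v′≡ij′

module _ {k d : ℕ} {T : Tree (Label k d)} (PT : IsParkingTree k d T) where
  open IsParkingTree PT

  labels-unique : Unique (labels T)
  labels-unique = Unique-resp-↭ (setoid _) (↭⇒↭ₛ (↭-sym labels-perm))
    (All.map⁺ (All.universal (λ _ ()) (allLabels k d)) ∷ Unique.map⁺ just-injective (Unique-allLabels k d))

  child-labelled : ∀ {u v} → Parent T u v → ∃ λ ij → labelAt v ≡ just ij
  child-labelled {u} {v} u→v with labelAt v in v≡
  ... | nothing = contradiction (subst (Parent T u) v≡root u→v) λ ()
    where
    v≡root : v ≡ here
    v≡root = labelAt-injective labels-unique (trans v≡ (sym root-∞))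
  ... | just ij = ij , refl

  block-parent-unique : ∀ {p p′ v v′ i j j′} → Parent T p v → labelAt v ≡ just (i , j) →
                        Parent T p′ v′ → labelAt v′ ≡ just (i , j′) → p ≡ p′
  block-parent-unique {p′ = p′} {j′ = j′} p→v v≡ij p′→v′ v′≡ij′
    with w , p→w , w≡ij′ ← block-sibling local p→v v≡ij j′
    = Parent-unique p→w
        (subst (Parent T p′) (labelAt-injective labels-unique (trans v′≡ij′ (sym w≡ij′))) p′→v′)

module _ {k d : ℕ} {T : Tree (Label k d)} (PT : IsParkingTree k d T) (O : IncreasingOrdering T (d * k + 1))
         {a : Fin k → ℕ}
         (a-parent : ∀ {p v i j} → Parent T p v → labelAt v ≡ just (i , j) →
                     a i ≡ suc (toℕ (IncreasingOrdering.ω O p))) where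
  open IncreasingOrdering O

  block-count : ∀ {c} → c ≤ d * k → c ≤ d * length (filter (λ i → a i ≤? c) (allFin k))
  block-count {c} c≤dk = injective⇒≤-count (λ i → a i ≤? c) label label-injective label-small
    where
    -- ω is 0-based while a is 1-based: vertex t has ω-value t + 1.
    vertex : Fin c → Pos T
    vertex t = ω⁻¹ O (fromℕ< (≤-<-trans (≤-trans (toℕ<n t) c≤dk) (m<m+n (d * k) z<s)))

    ω-vertex : ∀ t → toℕ (ω (vertex t)) ≡ suc (toℕ t)
    ω-vertex t = trans (cong toℕ (ω-ω⁻¹ O _)) (toℕ-fromℕ< _)

    parent : ∀ t → ∃ λ u → Parent T u (vertex t)
    parent t = ω>0⇒child O (subst (0 <_) (sym (ω-vertex t)) z<s)

    labelled : ∀ t → ∃ λ ij → labelAt (vertex t) ≡ just ij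
    labelled t = child-labelled PT (proj₂ (parent t))

    label : Fin c → Fin k × Fin d
    label t = proj₁ (labelled t)

    label-injective : Injective _≡_ _≡_ label
    label-injective {t} {t′} same-label = toℕ-injective (suc-injective (begin
      suc (toℕ t)          ≡⟨ ω-vertex t ⟨
      toℕ (ω (vertex t))   ≡⟨ cong (toℕ ∘ ω) same-vertex ⟩
      toℕ (ω (vertex t′))  ≡⟨ ω-vertex t′ ⟩
      suc (toℕ t′)         ∎))
      where
      open ≡-Reasoning
      same-vertex : vertex t ≡ vertex t′
      same-vertex = labelAt-injective (labels-unique PT)
        (trans (proj₂ (labelled t)) (trans (cong just same-label) (sym (proj₂ (labelled t′)))))

    label-small : ∀ t → a (proj₁ (label t)) ≤ c
    label-small t = begin
      a (proj₁ (label t))               ≡⟨ a-parent (proj₂ (parent t)) (proj₂ (labelled t)) ⟩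
      suc (toℕ (ω (proj₁ (parent t))))  ≤⟨ increasing (proj₂ (parent t)) ⟩
      toℕ (ω (vertex t))                ≡⟨ ω-vertex t ⟩
      suc (toℕ t)                       ≤⟨ toℕ<n t ⟩
      c                                 ∎
      where open ≤-Reasoning

lemma8p5 : (k d : ℕ) (T : Tree (Label k d)) → IsParkingTree k d T →
    (O : IncreasingOrdering T (d * k + 1)) →
    (a : Fin k → ℕ) →
    (∀ i → ∃ λ p → ∃ λ v → ∃ λ j →
       Parent T p v × labelAt v ≡ just (i , j) ×
       a i ≡ suc (toℕ (IncreasingOrdering.ω O p))) →
    IsDParkingFunction d (tabulate a)
lemma8p5 k d T PT O a a-def = parking-criterion d a positive λ m m<k →
  d*m+1≤d*n⇒m<n d (block-count PT O a-parent (m<n⇒d*m+1≤d*n (1≤d m<k) m<k))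
  where
  open IncreasingOrdering O

  a-parent : ∀ {p v i j} → Parent T p v → labelAt v ≡ just (i , j) → a i ≡ suc (toℕ (ω p))
  a-parent {i = i} p→v v≡ij with _ , _ , _ , p′→v′ , v′≡ij′ , a≡ ← a-def i
    = trans a≡ (cong (suc ∘ toℕ ∘ ω) (block-parent-unique PT p′→v′ v′≡ij′ p→v v≡ij))

  positive : ∀ i → 1 ≤ a i
  positive i with _ , _ , _ , _ , _ , a≡ ← a-def i = subst (1 ≤_) (sym a≡) (s≤s z≤n)

  1≤d : ∀ {m} → m < k → 1 ≤ d
  1≤d m<k with _ , _ , j , _ ← a-def (fromℕ< m<k) = ≤-<-trans z≤n (toℕ<n j)
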